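{- Let $x_1,\ldots,x_t\in G$ be such that $x_i\vee x_j<\infty$ for all $i,j$. Then $x_1\vee\cdots\vee x_t<\infty$.
   Context: Let $F$ be a set of unordered pairs of distinct elements of $[k]=\{1,\dots,k\}$, and $G=G_F$ the group generated by $g_1,\dots,g_k$ subject to $g_ig_j=g_jg_i$ for all distinct $i,j$ with $\{i,j\}\notin F$. For $x\in G$, $|x|$ is the minimum length of a word in $g_1^{\pm1},\dots,g_k^{\pm1}$ representing $x$. Write $x\le y$ iff $|y|=|x|+|x^{ -1}y|$; this is a partial order in which any two elements have a meet, and any family of elements with a common upper bound has a least upper bound (join) $\vee$. The join is written $\infty$ (infinite) when no common upper bound exists; $<\infty$ means a common upper bound exists. -}

module Defs where

open import Data.Nat using (ℕ; _+_; _≤_)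
open import Data.Fin using (Fin)
import Data.Fin
open import Data.Bool using (Bool; true; false; not)
open import Data.List using (List; []; _∷_; _++_; length; reverse; map)
open import Data.Product using (Σ; _×_; _,_; ∃)
open import Relation.Binary.PropositionalEquality using (_≡_; _≢_)
open import Relation.Binary.Construct.Closure.Equivalence using (EqClosure)

-- The set F of unordered pairs of distinct elements of [k] is encoded by a
-- Boolean function: {i,j} ∈ F  iff  F i j ≡ true or F j i ≡ true.
Pairs : ℕ → Set
Pairs k = Fin k → Fin k → Bool

-- A letter g_i^{+1} (true) or g_i^{-1} (false).
Letter : ℕ → Set
Letter k = Fin k × Bool

Word : ℕ → Set
Word k = List (Letter k)

invL : ∀ {k} → Letter k → Letter k
invL (i , s) = (i , not s)

inv : ∀ {k} → Word k → Word k
inv w = reverse (map invL w)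

data Step {k : ℕ} (F : Pairs k) : Word k → Word k → Set where
  cancel : ∀ (u v : Word k) (a : Letter k) →
           Step F (u ++ a ∷ invL a ∷ v) (u ++ v)
  swap   : ∀ (u v : Word k) (i j : Fin k) (s r : Bool) →
           i ≢ j → F i j ≡ false → F j i ≡ false →
           Step F (u ++ (i , s) ∷ (j , r) ∷ v) (u ++ (j , r) ∷ (i , s) ∷ v)

-- Two words represent the same element of G_F.
_≈[_]_ : ∀ {k} → Word k → Pairs k → Word k → Set
u ≈[ F ] v = EqClosure (Step F) u v

HasLength : ∀ {k} (F : Pairs k) → Word k → ℕ → Set
HasLength F x n =
  (Σ (Word _) λ w → (w ≈[ F ] x) × (length w ≡ n)) ×
  (∀ (w : Word _) → w ≈[ F ] x → n ≤ length w)

Below : ∀ {k} (F : Pairs k) → Word k → Word k → Set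
Below F x y = Σ ℕ λ a → Σ ℕ λ b → Σ ℕ λ c →
  HasLength F x a × HasLength F y b × HasLength F (inv x ++ y) c × (b ≡ a + c)

-- The family x has a common upper bound, i.e. its join is < ∞.
JoinFinite : ∀ {k} (F : Pairs k) {t : ℕ} → (Fin t → Word k) → Set
JoinFinite F x = Σ (Word _) λ z → ∀ i → Below F (x i) z

pair : ∀ {A : Set} → A → A → Fin 2 → A
pair a b Fin.zero = a
pair a b (Fin.suc _) = b

-- For every pair (c , d) of generators that coincide or do not commute, let π w c d be
-- the subword of w formed by its letters with generator c or d.  Reading a word letter by
-- letter onto these stacks, a letter cancelling exactly when its inverse is on top of every
-- stack it belongs to, gives stacks that are invariant under the defining relations of G_F.
-- The words read without cancellation are exactly the geodesics, so a geodesic is determined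
-- by its stacks and its length is the total size of the diagonal stacks π w c c.
-- If x ≤ z then every stack of x is a prefix of the corresponding stack of z, so pairwise
-- bounded elements have pairwise prefix-comparable stacks.  Two geodesics with comparable
-- stacks have a join, built from the front by taking the first letter of one of them and
-- moving it to the front of the other when it occurs there; folding this over the family
-- gives a common upper bound.

module Submission where

open import Defs
open import Data.Bool using (true; false; if_then_else_)
open import Data.Bool.Properties as Bool using (not-involutive)
open import Data.Fin using (Fin; zero; suc; _≟_)
open import Data.Fin.Properties using (all?; punchInᵢ≢i)
open import Data.List using (List; []; _∷_; _++_; _∷ʳ_; [_]; length; reverse; map; filter; foldl; last; head)
open import Data.List.Properties
  using (++-assoc; ++-identityʳ; ∷ʳ-++; length-++; length-++-sucʳ; filter-++; filter-accept; filter-reject;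
         foldl-++; reverse-map; reverse-involutive; unfold-reverse)
open import Data.List.Relation.Binary.Prefix.Heterogeneous using (Prefix; []; _∷_)
open import Data.List.Relation.Binary.Prefix.Propositional.Properties using (∣ˡ-as-Prefix)
open import Data.List.Relation.Unary.All using (All; []; _∷_; tabulate)
import Data.List.Relation.Unary.All.Properties as All
open import Data.List.Membership.Propositional using (_∈_)
open import Data.List.Membership.Propositional.Properties using (∈-filter⁺; ∈-filter⁻)
open import Data.List.Relation.Unary.Any using (here; there)
open import Data.Maybe using (just)
open import Data.Maybe.Properties as Maybe using (just-injective)
open import Data.Nat using (ℕ; zero; suc; _+_; _≤_; _<_; s≤s; s≤s⁻¹)
open import Data.Nat.Properties
  using (+-0-commutativeMonoid; +-assoc; +-suc; +-identityʳ; +-monoˡ-≤; +-cancelˡ-≤; ≤-reflexive; ≤-trans; ≤-antisym;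
         <-irrefl; <⇒≤; n<1+n; n≤1+n; m≤n⇒m≤1+n; module ≤-Reasoning)
open import Data.Product using (Σ; _×_; _,_; proj₁)
import Data.Product.Properties as Product
open import Data.Sum as Sum using (_⊎_; inj₁; inj₂)
open import Data.Vec.Functional using (Vector; removeAt)
open import Algebra.Properties.CommutativeMonoid.Sum +-0-commutativeMonoid
  using (sum; sum-remove; ∑-distrib-+; sum-cong-≗; sum-replicate-zero)
open import Function using (case_of_; _∘_; flip)
open import Relation.Nullary using (¬_; Dec; yes; no; does; _→-dec_; contradiction)
open import Relation.Nullary.Decidable using (dec-true; dec-false)
open import Relation.Binary.PropositionalEquality
  using (_≡_; _≢_; refl; sym; trans; cong; cong₂; subst; subst₂; module ≡-Reasoning)
open import Relation.Binary.Construct.Closure.ReflexiveTransitive using (ε; _◅_; _◅◅_)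
open import Relation.Binary.Construct.Closure.Symmetric using (fwd; bwd)
import Relation.Binary.Construct.Closure.Equivalence as EqClosure
import Relation.Binary.Reasoning.Setoid as SetoidReasoning

init : ∀ {A : Set} → List A → List A
init []           = []
init (x ∷ [])     = []
init (x ∷ y ∷ ys) = x ∷ init (y ∷ ys)

init-∷ʳ : ∀ {A : Set} (xs : List A) x → init (xs ∷ʳ x) ≡ xs
init-∷ʳ []           x = refl
init-∷ʳ (y ∷ [])     x = refl
init-∷ʳ (y ∷ z ∷ xs) x = cong (y ∷_) (init-∷ʳ (z ∷ xs) x)

last-∷ʳ : ∀ {A : Set} (xs : List A) x → last (xs ∷ʳ x) ≡ just x
last-∷ʳ []           x = refl
last-∷ʳ (y ∷ [])     x = refl
last-∷ʳ (y ∷ z ∷ xs) x = last-∷ʳ (z ∷ xs) x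

last-∷ : ∀ {A : Set} {x : A} {xs} → xs ≢ [] → last (x ∷ xs) ≡ last xs
last-∷ {xs = []}    xs≢[] = contradiction refl xs≢[]
last-∷ {xs = _ ∷ _} xs≢[] = refl

last-∈ : ∀ {A : Set} (xs : List A) {x} → last xs ≡ just x → x ∈ xs
last-∈ (y ∷ [])     refl = here refl
last-∈ (y ∷ z ∷ xs) e    = there (last-∈ (z ∷ xs) e)

≡∷⇒≢[] : ∀ {A : Set} {xs : List A} {y ys} → xs ≡ y ∷ ys → xs ≢ []
≡∷⇒≢[] refl ()

prefix-[] : ∀ {A : Set} {xs : List A} → Prefix _≡_ xs [] → xs ≡ []
prefix-[] [] = refl

head-++ : ∀ {A : Set} (xs : List A) {ys x} → head xs ≡ just x → head (xs ++ ys) ≡ just x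
head-++ (_ ∷ _) hd = hd

head-∈ : ∀ {A : Set} (xs : List A) {x} → head xs ≡ just x → x ∈ xs
head-∈ (y ∷ xs) refl = here refl

Comparable : ∀ {A : Set} → List A → List A → Set
Comparable xs ys = Prefix _≡_ xs ys ⊎ Prefix _≡_ ys xs

comparable-sym : ∀ {A : Set} {xs ys : List A} → Comparable xs ys → Comparable ys xs
comparable-sym = Sum.swap

prefixes-comparable : ∀ {A : Set} {xs ys zs : List A} → Prefix _≡_ xs zs → Prefix _≡_ ys zs → Comparable xs ys
prefixes-comparable []             _              = inj₁ []
prefixes-comparable (_ ∷ _)        []             = inj₂ []
prefixes-comparable (refl ∷ xs≤zs) (refl ∷ ys≤zs) =
  Sum.map (refl ∷_) (refl ∷_) (prefixes-comparable xs≤zs ys≤zs)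

comparable-tail : ∀ {A : Set} {x y : A} {xs ys} → Comparable (x ∷ xs) (y ∷ ys) → Comparable xs ys
comparable-tail (inj₁ (_ ∷ xs≤ys)) = inj₁ xs≤ys
comparable-tail (inj₂ (_ ∷ ys≤xs)) = inj₂ ys≤xs

comparable-head : ∀ {A : Set} {xs ys : List A} {y} → Comparable xs ys → xs ≢ [] → head ys ≡ just y → head xs ≡ just y
comparable-head {xs = []}    _                 xs≢[] _  = contradiction refl xs≢[]
comparable-head {xs = _ ∷ _} (inj₁ (refl ∷ _)) _     hd = hd
comparable-head {xs = _ ∷ _} (inj₂ (refl ∷ _)) _     hd = hd

sum-indicator : ∀ {n} (i : Fin n) (t : Vector ℕ n) → t i ≡ 1 → (∀ j → j ≢ i → t j ≡ 0) → sum t ≡ 1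
sum-indicator {suc n} i t tᵢ≡1 t≡0 = begin
  sum t                    ≡⟨ sum-remove {i = i} t ⟩
  t i + sum (removeAt t i) ≡⟨ cong₂ _+_ tᵢ≡1 (sum-cong-≗ {n} {removeAt t i} {λ _ → 0} λ j → t≡0 _ (punchInᵢ≢i i j)) ⟩
  1 + sum {n} (λ _ → 0)    ≡⟨ cong (1 +_) (sum-replicate-zero n) ⟩
  1                        ∎
  where open ≡-Reasoning

module Projections {k : ℕ} (F : Pairs k) where

  gen : Letter k → Fin k
  gen = proj₁

  data Linked (c d : Fin k) : Set where
    same  : c ≡ d → Linked c d
    edge  : F c d ≡ true → Linked c d
    edge′ : F d c ≡ true → Linked c d

  data Incident : Fin k → Fin k → Fin k → Set where
    left  : ∀ {c d} → Linked c d → Incident c c d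
    right : ∀ {c d} → Linked c d → Incident d c d

  Commute : Letter k → Letter k → Set
  Commute a b = ¬ Linked (gen a) (gen b)

  linked? : ∀ c d → Dec (Linked c d)
  linked? c d with c ≟ d | F c d in fcd | F d c in fdc
  ... | yes c≡d | _     | _     = yes (same c≡d)
  ... | no _    | true  | _     = yes (edge fcd)
  ... | no _    | false | true  = yes (edge′ fdc)
  ... | no c≢d  | false | false = no λ where
    (same c≡d) → c≢d c≡d
    (edge e)   → contradiction (trans (sym fcd) e) λ ()
    (edge′ e)  → contradiction (trans (sym fdc) e) λ ()

  incident? : ∀ l c d → Dec (Incident l c d)
  incident? l c d with linked? c d | l ≟ c | l ≟ d
  ... | no ¬cd | _        | _        = no λ where
    (left cd)  → ¬cd cd
    (right cd) → ¬cd cd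
  ... | yes cd | yes refl | _        = yes (left cd)
  ... | yes cd | no _     | yes refl = yes (right cd)
  ... | yes cd | no l≢c   | no l≢d   = no λ where
    (left _)  → l≢c refl
    (right _) → l≢d refl

  linked-sym : ∀ {c d} → Linked c d → Linked d c
  linked-sym (same c≡d) = same (sym c≡d)
  linked-sym (edge e)   = edge′ e
  linked-sym (edge′ e)  = edge e

  Commute-sym : ∀ {a b} → Commute a b → Commute b a
  Commute-sym ab = ab ∘ linked-sym

  incident-diag : ∀ l → Incident l l l
  incident-diag l = left (same refl)

  incident-diag⇒≡ : ∀ {l m} → Incident l m m → l ≡ m
  incident-diag⇒≡ (left _)  = refl
  incident-diag⇒≡ (right _) = refl

  coincident⇒linked : ∀ {l m c d} → Incident l c d → Incident m c d → Linked l m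
  coincident⇒linked (left _)   (left _)   = same refl
  coincident⇒linked (right _)  (right _)  = same refl
  coincident⇒linked (left cd)  (right _)  = cd
  coincident⇒linked (right cd) (left _)   = linked-sym cd

  incident-commuting : ∀ {a b c d} → Commute a b → Incident (gen a) c d → ¬ Incident (gen b) c d
  incident-commuting ab ia ib = ab (coincident⇒linked ia ib)

  infix 4 _≈_
  _≈_ : Word k → Word k → Set
  u ≈ v = u ≈[ F ] v

  ≈-refl : ∀ {u} → u ≈ u
  ≈-refl = ε

  ≈-sym : ∀ {u v} → u ≈ v → v ≈ u
  ≈-sym = EqClosure.symmetric (Step F)

  ≈-trans : ∀ {u v w} → u ≈ v → v ≈ w → u ≈ w
  ≈-trans = _◅◅_

  ≡⇒≈ : ∀ {u v} → u ≡ v → u ≈ v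
  ≡⇒≈ refl = ε

  module ≈-Reasoning = SetoidReasoning (EqClosure.setoid (Step F))

  step-++ˡ : ∀ p {u v} → Step F u v → Step F (p ++ u) (p ++ v)
  step-++ˡ p (cancel u v a) =
    subst₂ (Step F) (++-assoc p u _) (++-assoc p u v) (cancel (p ++ u) v a)
  step-++ˡ p (swap u v i j s r i≢j fij fji) =
    subst₂ (Step F) (++-assoc p u _) (++-assoc p u _) (swap (p ++ u) v i j s r i≢j fij fji)

  step-++ʳ : ∀ q {u v} → Step F u v → Step F (u ++ q) (v ++ q)
  step-++ʳ q (cancel u v a) =
    subst₂ (Step F) (sym (++-assoc u _ q)) (sym (++-assoc u v q)) (cancel u (v ++ q) a)
  step-++ʳ q (swap u v i j s r i≢j fij fji) =
    subst₂ (Step F) (sym (++-assoc u _ q)) (sym (++-assoc u _ q)) (swap u (v ++ q) i j s r i≢j fij fji)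

  ≈-++ˡ : ∀ p {u v} → u ≈ v → p ++ u ≈ p ++ v
  ≈-++ˡ p = EqClosure.gmap (p ++_) (step-++ˡ p)

  ≈-++ʳ : ∀ q {u v} → u ≈ v → u ++ q ≈ v ++ q
  ≈-++ʳ q = EqClosure.gmap (_++ q) (step-++ʳ q)

  ≈-∷ : ∀ a {u v} → u ≈ v → a ∷ u ≈ a ∷ v
  ≈-∷ a = ≈-++ˡ [ a ]

  cancel-∷ : ∀ a w → a ∷ invL a ∷ w ≈ w
  cancel-∷ a w = fwd (cancel [] w a) ◅ ε

  swap-∷ : ∀ {a b} w → Commute a b → a ∷ b ∷ w ≈ b ∷ a ∷ w
  swap-∷ {i , s} {j , r} w ab with F i j in fij | F j i in fji
  ... | true  | _     = contradiction (edge fij) ab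
  ... | false | true  = contradiction (edge′ fji) ab
  ... | false | false = fwd (swap [] w i j s r (ab ∘ same) fij fji) ◅ ε

  move-∷ : ∀ {a} p w → All (Commute a) p → p ++ a ∷ w ≈ a ∷ p ++ w
  move-∷ []      w []         = ≈-refl
  move-∷ {a} (b ∷ p) w (ab ∷ aps) = ≈-trans (≈-∷ b (move-∷ p w aps)) (swap-∷ {b} (p ++ w) (Commute-sym {a} {b} ab))

  invL-involutive : ∀ (a : Letter k) → invL (invL a) ≡ a
  invL-involutive (i , s) = cong (i ,_) (not-involutive s)

  inv-involutive : ∀ (x : Word k) → inv (inv x) ≡ x
  inv-involutive x = begin
    reverse (map invL (reverse (map invL x))) ≡⟨ cong reverse (reverse-map invL (map invL x)) ⟩
    reverse (reverse (map invL (map invL x))) ≡⟨ reverse-involutive _ ⟩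
    map invL (map invL x)                     ≡⟨ map-involutive x ⟩
    x                                         ∎
    where
    open ≡-Reasoning
    map-involutive : ∀ (x : Word k) → map invL (map invL x) ≡ x
    map-involutive []      = refl
    map-involutive (a ∷ x) = cong₂ _∷_ (invL-involutive a) (map-involutive x)

  ++-inv-cancel : ∀ (x z : Word k) → x ++ inv x ++ z ≈ z
  ++-inv-cancel []      z = ≈-refl
  ++-inv-cancel (a ∷ x) z rewrite unfold-reverse (invL a) (map invL x) | ++-assoc (inv x) [ invL a ] z =
    ≈-trans (≈-∷ a (++-inv-cancel x (invL a ∷ z))) (cancel-∷ a z)

  inv-++-cancel : ∀ (x z : Word k) → inv x ++ x ++ z ≈ z
  inv-++-cancel x z = subst (λ y → inv x ++ y ++ z ≈ z) (inv-involutive x) (++-inv-cancel (inv x) z)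

  -- Projection stacks

  Stacks : Set
  Stacks = Fin k → Fin k → Word k

  infix 4 _≐_
  _≐_ : Stacks → Stacks → Set
  S ≐ T = ∀ c d → S c d ≡ T c d

  ≐-refl : ∀ {S} → S ≐ S
  ≐-refl c d = refl

  ≐-sym : ∀ {S T} → S ≐ T → T ≐ S
  ≐-sym S≐T c d = sym (S≐T c d)

  ≐-trans : ∀ {S T U} → S ≐ T → T ≐ U → S ≐ U
  ≐-trans S≐T T≐U c d = trans (S≐T c d) (T≐U c d)

  ≡⇒≐ : ∀ {S T} → S ≡ T → S ≐ T
  ≡⇒≐ refl c d = refl

  π : Word k → Stacks
  π w c d = filter (λ a → incident? (gen a) c d) w

  π-++ : ∀ u v c d → π (u ++ v) c d ≡ π u c d ++ π v c d
  π-++ u v c d = filter-++ (λ a → incident? (gen a) c d) u v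

  π-∷-yes : ∀ {a w c d} → Incident (gen a) c d → π (a ∷ w) c d ≡ a ∷ π w c d
  π-∷-yes {c = c} {d} = filter-accept (λ a → incident? (gen a) c d)

  π-∷-no : ∀ {a w c d} → ¬ Incident (gen a) c d → π (a ∷ w) c d ≡ π w c d
  π-∷-no {c = c} {d} = filter-reject (λ a → incident? (gen a) c d)

  π-∷ʳ-yes : ∀ {a} w {c d} → Incident (gen a) c d → π (w ∷ʳ a) c d ≡ π w c d ∷ʳ a
  π-∷ʳ-yes w {c} {d} i = trans (π-++ w _ c d) (cong (π w c d ++_) (π-∷-yes i))

  π-∷ʳ-no : ∀ {a} w {c d} → ¬ Incident (gen a) c d → π (w ∷ʳ a) c d ≡ π w c d
  π-∷ʳ-no w {c} {d} ¬i = trans (π-++ w _ c d) (trans (cong (π w c d ++_) (π-∷-no ¬i)) (++-identityʳ _))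

  ∈-π⁻ : ∀ {x} w {c d} → x ∈ π w c d → x ∈ w × Incident (gen x) c d
  ∈-π⁻ w {c} {d} = ∈-filter⁻ (λ a → incident? (gen a) c d)

  ∈-π⁺ : ∀ {x w c d} → x ∈ w → Incident (gen x) c d → x ∈ π w c d
  ∈-π⁺ {c = c} {d} = ∈-filter⁺ (λ a → incident? (gen a) c d)

  π-commuting : ∀ {a p c d} → All (Commute a) p → Incident (gen a) c d → π p c d ≡ []
  π-commuting []         i = refl
  π-commuting {a} {b ∷ p} (ab ∷ aps) i = trans (π-∷-no (incident-commuting {a} {b} ab i)) (π-commuting {a} aps i)

  Cancels : Letter k → Stacks → Set
  Cancels a S = ∀ c d → Incident (gen a) c d → last (S c d) ≡ just (invL a)

  _≟ˡ_ : (a b : Letter k) → Dec (a ≡ b)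
  _≟ˡ_ = Product.≡-dec _≟_ Bool._≟_

  cancels? : ∀ a S → Dec (Cancels a S)
  cancels? a S = all? λ c → all? λ d →
    incident? (gen a) c d →-dec Maybe.≡-dec _≟ˡ_ (last (S c d)) (just (invL a))

  Cancels-resp : ∀ {a S T} → (∀ c d → Incident (gen a) c d → S c d ≡ T c d) → Cancels a S → Cancels a T
  Cancels-resp S≡T h c d i = trans (cong last (sym (S≡T c d i))) (h c d i)

  onIncident : Fin k → (Word k → Word k) → Stacks → Stacks
  onIncident l f S c d = if does (incident? l c d) then f (S c d) else S c d

  onIncident-yes : ∀ {l f S c d} → Incident l c d → onIncident l f S c d ≡ f (S c d)
  onIncident-yes {l} {c = c} {d} i rewrite dec-true (incident? l c d) i = refl

  onIncident-no : ∀ {l f S c d} → ¬ Incident l c d → onIncident l f S c d ≡ S c d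
  onIncident-no {l} {c = c} {d} ¬i rewrite dec-false (incident? l c d) ¬i = refl

  onIncident-resp : ∀ l f {S T} → S ≐ T → onIncident l f S ≐ onIncident l f T
  onIncident-resp l f S≐T c d with incident? l c d
  ... | yes _ = cong f (S≐T c d)
  ... | no _  = S≐T c d

  push pop : Letter k → Stacks → Stacks
  push a = onIncident (gen a) (_∷ʳ a)
  pop  a = onIncident (gen a) init

  step : Letter k → Stacks → Stacks
  step a S with cancels? a S
  ... | yes _ = pop a S
  ... | no _  = push a S

  step-pop : ∀ {a S} → Cancels a S → step a S ≡ pop a S
  step-pop {a} {S} h with cancels? a S
  ... | yes _  = refl
  ... | no ¬h  = contradiction h ¬h

  step-push : ∀ {a S} → ¬ Cancels a S → step a S ≡ push a S
  step-push {a} {S} ¬h with cancels? a S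
  ... | yes h = contradiction h ¬h
  ... | no _  = refl

  step-outside : ∀ {a S c d} → ¬ Incident (gen a) c d → step a S c d ≡ S c d
  step-outside {a} {S} ¬i with cancels? a S
  ... | yes _ = onIncident-no {f = init} {S} ¬i
  ... | no _  = onIncident-no {f = _∷ʳ a} {S} ¬i

  step-local : ∀ {a S T c d} → (∀ c d → Incident (gen a) c d → S c d ≡ T c d) →
               Incident (gen a) c d → step a S c d ≡ step a T c d
  step-local {a} {S} {T} S≡T i with cancels? a S | cancels? a T
  ... | yes _  | yes _  = trans (onIncident-yes {f = init} {S} i)
                            (trans (cong init (S≡T _ _ i)) (sym (onIncident-yes {f = init} {T} i)))
  ... | no _   | no _   = trans (onIncident-yes {f = _∷ʳ a} {S} i)
                            (trans (cong (_∷ʳ a) (S≡T _ _ i)) (sym (onIncident-yes {f = _∷ʳ a} {T} i)))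
  ... | yes hS | no ¬hT = contradiction (Cancels-resp S≡T hS) ¬hT
  ... | no ¬hS | yes hT = contradiction (Cancels-resp (λ c d i → sym (S≡T c d i)) hT) ¬hS

  step-resp : ∀ a {S T} → S ≐ T → step a S ≐ step a T
  step-resp a S≐T c d with incident? (gen a) c d
  ... | yes i = step-local (λ c d _ → S≐T c d) i
  ... | no ¬i = trans (step-outside ¬i) (trans (S≐T c d) (sym (step-outside ¬i)))

  step-commute : ∀ {a b} S → Commute a b → step b (step a S) ≐ step a (step b S)
  step-commute {a} {b} S ab c d with incident? (gen a) c d | incident? (gen b) c d
  ... | yes ia | _      = trans (step-outside (incident-commuting {a} {b} ab ia))
                            (step-local (λ c d i → sym (step-outside (incident-commuting {a} {b} ab i))) ia)
  ... | no ¬ia | yes ib =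
    trans (step-local (λ c d i → step-outside (incident-commuting {b} {a} (Commute-sym {a} {b} ab) i)) ib)
          (sym (step-outside ¬ia))
  ... | no ¬ia | no ¬ib = trans (step-outside ¬ib) (trans (step-outside ¬ia)
                            (sym (trans (step-outside ¬ia) (step-outside ¬ib))))

  run : Word k → Stacks → Stacks
  run w S = foldl (flip step) S w

  run-++ : ∀ u v S → run (u ++ v) S ≡ run v (run u S)
  run-++ u v S = foldl-++ (flip step) S u v

  run-resp : ∀ w {S T} → S ≐ T → run w S ≐ run w T
  run-resp []      S≐T = S≐T
  run-resp (a ∷ w) S≐T = run-resp w (step-resp a S≐T)

  push-π : ∀ a r → push a (π r) ≐ π (r ∷ʳ a)
  push-π a r c d with incident? (gen a) c d
  ... | yes i = sym (π-∷ʳ-yes r i)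
  ... | no ¬i = sym (π-∷ʳ-no r ¬i)

  data Reduced : Word k → Set where
    []   : Reduced []
    snoc : ∀ {r} a → Reduced r → ¬ Cancels a (π r) → Reduced (r ∷ʳ a)

  π-middle-yes : ∀ {b} p q {c d} → All (Commute b) q → Incident (gen b) c d →
                 π (p ++ b ∷ q) c d ≡ π p c d ∷ʳ b
  π-middle-yes {b} p q {c} {d} bq i = begin
    π (p ++ b ∷ q) c d     ≡⟨ π-++ p (b ∷ q) c d ⟩
    π p c d ++ π (b ∷ q) c d ≡⟨ cong (π p c d ++_) (trans (π-∷-yes i) (cong (b ∷_) (π-commuting {b} bq i))) ⟩
    π p c d ∷ʳ b           ∎
    where open ≡-Reasoning

  π-middle-no : ∀ {b} p q {c d} → ¬ Incident (gen b) c d → π (p ++ b ∷ q) c d ≡ π (p ++ q) c d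
  π-middle-no p q {c} {d} ¬i =
    trans (π-++ p _ c d) (trans (cong (π p c d ++_) (π-∷-no ¬i)) (sym (π-++ p q c d)))

  π-++-commuting : ∀ {b} p q {c d} → All (Commute b) q → Incident (gen b) c d → π (p ++ q) c d ≡ π p c d
  π-++-commuting {b} p q {c} {d} bq i =
    trans (π-++ p q c d) (trans (cong (π p c d ++_) (π-commuting {b} bq i)) (++-identityʳ _))

  pop-middle : ∀ {b} p q → All (Commute b) q → pop b (π (p ++ b ∷ q)) ≐ π (p ++ q)
  pop-middle {b} p q bq c d with incident? (gen b) c d
  ... | yes i = begin
    init (π (p ++ b ∷ q) c d) ≡⟨ cong init (π-middle-yes {b} p q bq i) ⟩
    init (π p c d ∷ʳ b)       ≡⟨ init-∷ʳ _ b ⟩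
    π p c d                   ≡⟨ π-++-commuting {b} p q bq i ⟨
    π (p ++ q) c d            ∎
    where open ≡-Reasoning
  ... | no ¬i = π-middle-no {b} p q ¬i

  push-middle : ∀ {b} p q → All (Commute b) q → push b (π (p ++ q)) ≐ π (p ++ b ∷ q)
  push-middle {b} p q bq c d with incident? (gen b) c d
  ... | yes i = trans (cong (_∷ʳ b) (π-++-commuting {b} p q bq i)) (sym (π-middle-yes {b} p q bq i))
  ... | no ¬i = sym (π-middle-no {b} p q ¬i)

  record Cancellation (a : Letter k) (r : Word k) : Set where
    field
      before after : Word k
      split : r ≡ before ++ invL a ∷ after
      after-commutes : All (Commute a) after
      before-noncancelling : ¬ Cancels (invL a) (π before)
      reduced : Reduced (before ++ after)

  cancels-last-linked : ∀ {a b} r → Linked (gen a) (gen b) → Cancels a (π (r ∷ʳ b)) → invL a ≡ b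
  cancels-last-linked {a} {b} r ab h = just-injective (begin
    just (invL a)                     ≡⟨ h _ _ (left ab) ⟨
    last (π (r ∷ʳ b) (gen a) (gen b)) ≡⟨ cong last (π-∷ʳ-yes r (right ab)) ⟩
    last (π r (gen a) (gen b) ∷ʳ b)   ≡⟨ last-∷ʳ (π r (gen a) (gen b)) b ⟩
    just b                            ∎)
    where open ≡-Reasoning

  cancellation : ∀ {a r} → Reduced r → Cancels a (π r) → Cancellation a r
  cancellation {a} [] h = contradiction (h _ _ (incident-diag (gen a))) λ ()
  cancellation {a} (snoc {r} b red ¬cb) h with linked? (gen a) (gen b)
  ... | yes ab with refl ← cancels-last-linked r ab h = record
      { before = r ; after = [] ; split = refl ; after-commutes = []
      ; before-noncancelling = ¬cb
      ; reduced = subst Reduced (sym (++-identityʳ r)) red }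
  ... | no ab = record
      { before = before ; after = after ∷ʳ b
      ; split = trans (cong (_∷ʳ b) split) (++-assoc before (invL a ∷ after) [ b ])
      ; after-commutes = All.++⁺ after-commutes (ab ∷ [])
      ; before-noncancelling = before-noncancelling
      ; reduced = subst Reduced (++-assoc before after [ b ]) (snoc b reduced ¬cb′) }
    where
    open Cancellation (cancellation red (Cancels-resp (λ c d i → π-∷ʳ-no r (incident-commuting {a} {b} ab i)) h))
    ¬cb′ : ¬ Cancels b (π (before ++ after))
    ¬cb′ = ¬cb ∘ Cancels-resp λ c d i →
      sym (trans (cong (λ x → π x c d) split)
                 (π-middle-no {invL a} before after (incident-commuting {b} {a} (Commute-sym {a} {b} ab) i)))

  module _ {a r} (C : Cancellation a r) where
    open Cancellation C

    pop-cancellation : pop a (π r) ≐ π (before ++ after)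
    pop-cancellation = ≐-trans (onIncident-resp (gen a) init λ c d → cong (λ x → π x c d) split)
                               (pop-middle {invL a} before after after-commutes)

    cancellation-≈ : ∀ w → r ++ a ∷ w ≈ (before ++ after) ++ w
    cancellation-≈ w = begin
      r ++ a ∷ w                             ≡⟨ cong (_++ a ∷ w) split ⟩
      (before ++ invL a ∷ after) ++ a ∷ w    ≡⟨ ++-assoc before _ (a ∷ w) ⟩
      before ++ invL a ∷ after ++ a ∷ w      ≈⟨ ≈-++ˡ before (≈-∷ (invL a) (move-∷ {a} after w after-commutes)) ⟩
      before ++ invL a ∷ a ∷ after ++ w      ≈⟨ ≈-++ˡ before (subst (λ x → invL a ∷ x ∷ after ++ w ≈ after ++ w)
                                                                   (invL-involutive a) (cancel-∷ (invL a) (after ++ w))) ⟩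
      before ++ after ++ w                   ≡⟨ ++-assoc before after w ⟨
      (before ++ after) ++ w                 ∎
      where open ≈-Reasoning

    cancellation-length : ∀ w → length (r ++ a ∷ w) ≡ suc (suc (length ((before ++ after) ++ w)))
    cancellation-length w = begin
      length (r ++ a ∷ w)                           ≡⟨ length-++-sucʳ r a w ⟩
      suc (length (r ++ w))                         ≡⟨ cong (λ x → suc (length (x ++ w))) split ⟩
      suc (length ((before ++ invL a ∷ after) ++ w)) ≡⟨ cong (λ v → suc (length v)) (++-assoc before _ w) ⟩
      suc (length (before ++ invL a ∷ after ++ w))  ≡⟨ cong suc (length-++-sucʳ before (invL a) (after ++ w)) ⟩
      suc (suc (length (before ++ after ++ w)))     ≡⟨ cong (λ v → suc (suc (length v))) (++-assoc before after w) ⟨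
      suc (suc (length ((before ++ after) ++ w)))   ∎
      where open ≡-Reasoning

  cancels-∷ʳ-inverse : ∀ a r → Cancels (invL a) (π (r ∷ʳ a))
  cancels-∷ʳ-inverse a r c d i =
    trans (cong last (π-∷ʳ-yes r i)) (trans (last-∷ʳ (π r c d) a) (cong just (sym (invL-involutive a))))

  step-inverse : ∀ a {r} → Reduced r → step (invL a) (step a (π r)) ≐ π r
  step-inverse a {r} red with cancels? a (π r)
  -- pop a and pop (invL a) coincide: both act on the stacks incident to gen a.
  ... | no ¬h = ≐-trans (step-resp (invL a) (push-π a r)) λ c d →
    trans (≡⇒≐ (step-pop (cancels-∷ʳ-inverse a r)) c d)
          (trans (pop-middle {a} r [] [] c d) (cong (λ x → π x c d) (++-identityʳ r)))
  ... | yes h = ≐-trans (step-resp (invL a) (pop-cancellation C)) λ c d →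
    trans (≡⇒≐ (step-push ¬h′) c d)
          (trans (push-middle {invL a} before after after-commutes c d) (cong (λ x → π x c d) (sym split)))
    where
    C = cancellation red h
    open Cancellation C
    ¬h′ : ¬ Cancels (invL a) (π (before ++ after))
    ¬h′ = before-noncancelling ∘ Cancels-resp λ c d i → π-++-commuting {a} before after after-commutes i

  record Reduction (r w : Word k) : Set where
    field
      result : Word k
      reduced : Reduced result
      run-π : run w (π r) ≐ π result
      ≈-result : r ++ w ≈ result
      shortens : result ≡ r ++ w ⊎ length result < length (r ++ w)

    result-≤ : length result ≤ length (r ++ w)
    result-≤ with shortens
    ... | inj₁ e = ≤-reflexive (cong length e)
    ... | inj₂ lt = <⇒≤ lt

  reduce : ∀ {r} w → Reduced r → Reduction r w
  reduce {r} [] red = record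
    { result = r ; reduced = red ; run-π = ≐-refl
    ; ≈-result = ≡⇒≈ (++-identityʳ r) ; shortens = inj₁ (sym (++-identityʳ r)) }
  reduce {r} (a ∷ w) red with cancels? a (π r)
  ... | no ¬h = record
    { result = result ; reduced = reduced
    ; run-π = ≐-trans (run-resp w (≐-trans (≡⇒≐ (step-push ¬h)) (push-π a r))) run-π
    ; ≈-result = subst (_≈ result) (∷ʳ-++ r a w) ≈-result
    ; shortens = Sum.map (λ e → trans e (∷ʳ-++ r a w)) (subst (λ x → length result < length x) (∷ʳ-++ r a w)) shortens }
    where open Reduction (reduce w (snoc a red ¬h))
  ... | yes h = record
    { result = result ; reduced = reduced
    ; run-π = ≐-trans (run-resp w (≐-trans (≡⇒≐ (step-pop h)) (pop-cancellation C))) run-π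
    ; ≈-result = ≈-trans (cancellation-≈ C w) ≈-result
    ; shortens = inj₂ (≤-trans (s≤s (m≤n⇒m≤1+n result-≤)) (≤-reflexive (sym (cancellation-length C w)))) }
    where
    C = cancellation red h
    open Reduction (reduce w (Cancellation.reduced C))

  run-resp-step : ∀ {u v} → Step F u v → run u (π []) ≐ run v (π [])
  run-resp-step (cancel p q a) rewrite run-++ p (a ∷ invL a ∷ q) (π []) | run-++ p q (π []) =
    run-resp q (≐-trans (step-resp (invL a) (step-resp a run-π))
                        (≐-trans (step-inverse a reduced) (≐-sym run-π)))
    where open Reduction (reduce p [])
  run-resp-step (swap p q i j s r i≢j fij fji)
    rewrite run-++ p ((i , s) ∷ (j , r) ∷ q) (π []) | run-++ p ((j , r) ∷ (i , s) ∷ q) (π []) =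
    run-resp q (step-commute _ ij)
    where
    ij : Commute (i , s) (j , r)
    ij (same i≡j) = i≢j i≡j
    ij (edge e)   = contradiction (trans (sym fij) e) λ ()
    ij (edge′ e)  = contradiction (trans (sym fji) e) λ ()

  run-resp-≈ : ∀ {u v} → u ≈ v → run u (π []) ≐ run v (π [])
  run-resp-≈ ε             = ≐-refl
  run-resp-≈ (fwd s ◅ u≈v) = ≐-trans (run-resp-step s) (run-resp-≈ u≈v)
  run-resp-≈ (bwd s ◅ u≈v) = ≐-trans (≐-sym (run-resp-step s)) (run-resp-≈ u≈v)

  sum-length-π-diag : ∀ w → sum (λ c → length (π w c c)) ≡ length w
  sum-length-π-diag []      = sum-replicate-zero k
  sum-length-π-diag (a ∷ w) = begin
    sum (λ c → length (π (a ∷ w) c c))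
      ≡⟨ sum-cong-≗ (λ c → cong length (π-++ [ a ] w c c)) ⟩
    sum (λ c → length (π [ a ] c c ++ π w c c))
      ≡⟨ sum-cong-≗ (λ c → length-++ (π [ a ] c c)) ⟩
    sum (λ c → length (π [ a ] c c) + length (π w c c))
      ≡⟨ ∑-distrib-+ (λ c → length (π [ a ] c c)) _ ⟩
    sum (λ c → length (π [ a ] c c)) + sum (λ c → length (π w c c))
      ≡⟨ cong₂ _+_ single (sum-length-π-diag w) ⟩
    suc (length w)
      ∎
    where
    open ≡-Reasoning
    single : sum (λ c → length (π [ a ] c c)) ≡ 1
    single = sum-indicator (gen a) _ (cong length (π-∷-yes {a} {[]} (incident-diag (gen a))))
               λ c c≢a → cong length (π-∷-no {a} {[]} (c≢a ∘ sym ∘ incident-diag⇒≡))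

  -- Normal forms and length

  π-length : ∀ {u v} → π u ≐ π v → length u ≡ length v
  π-length {u} {v} u≐v = begin
    length u                         ≡⟨ sum-length-π-diag u ⟨
    sum (λ c → length (π u c c))     ≡⟨ sum-cong-≗ (λ c → cong length (u≐v c c)) ⟩
    sum (λ c → length (π v c c))     ≡⟨ sum-length-π-diag v ⟩
    length v                         ∎
    where open ≡-Reasoning

  module _ (w : Word k) where
    private
      module R = Reduction (reduce w [])

    nf : Word k
    nf = R.result

    nf-reduced : Reduced nf
    nf-reduced = R.reduced

    run-nf : run w (π []) ≐ π nf
    run-nf = R.run-π

    ≈-nf : w ≈ nf
    ≈-nf = R.≈-result

    ∣_∣ : ℕ
    ∣_∣ = length nf

    ∣∣≤length : ∣_∣ ≤ length w
    ∣∣≤length = R.result-≤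

    ∣∣≡length⇒reduced : ∣_∣ ≡ length w → Reduced w
    ∣∣≡length⇒reduced ∣w∣≡ with R.shortens
    ... | inj₁ nf≡w = subst Reduced nf≡w R.reduced
    ... | inj₂ ∣w∣< = contradiction ∣w∣< (<-irrefl ∣w∣≡)

  ∣∣-resp-≈ : ∀ {u v} → u ≈ v → ∣ u ∣ ≡ ∣ v ∣
  ∣∣-resp-≈ {u} {v} u≈v = π-length {nf u} {nf v} (≐-trans (≐-sym (run-nf u)) (≐-trans (run-resp-≈ u≈v) (run-nf v)))

  ∣∣-minimal : ∀ {u v} → v ≈ u → ∣ u ∣ ≤ length v
  ∣∣-minimal {u} {v} v≈u = subst (_≤ length v) (∣∣-resp-≈ v≈u) (∣∣≤length v)

  ∣∣-++ : ∀ u v → ∣ u ++ v ∣ ≤ ∣ u ∣ + ∣ v ∣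
  ∣∣-++ u v = subst (∣ u ++ v ∣ ≤_) (length-++ (nf u))
    (∣∣-minimal (≈-sym (≈-trans (≈-++ʳ v (≈-nf u)) (≈-++ˡ (nf u) (≈-nf v)))))

  run-reduced : ∀ {w} → Reduced w → run w (π []) ≐ π w
  run-reduced [] = ≐-refl
  run-reduced (snoc {r} a red ¬h) rewrite run-++ r [ a ] (π []) =
    ≐-trans (step-resp a (run-reduced red)) (≐-trans (≡⇒≐ (step-push ¬h)) (push-π a r))

  reduced⇒∣∣≡length : ∀ {w} → Reduced w → ∣ w ∣ ≡ length w
  reduced⇒∣∣≡length {w} red = π-length {nf w} {w} (≐-trans (≐-sym (run-nf w)) (run-reduced red))

  ≈⇒π≐ : ∀ {u v} → Reduced u → Reduced v → u ≈ v → π u ≐ π v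
  ≈⇒π≐ ru rv u≈v = ≐-trans (≐-sym (run-reduced ru)) (≐-trans (run-resp-≈ u≈v) (run-reduced rv))

  hasLength : ∀ w → HasLength F w ∣ w ∣
  hasLength w = (nf w , ≈-sym (≈-nf w) , refl) , λ v v≈w → ∣∣-minimal v≈w

  HasLength⇒≡∣∣ : ∀ {w n} → HasLength F w n → n ≡ ∣ w ∣
  HasLength⇒≡∣∣ {w} ((v , v≈w , ∣v∣≡n) , minimal) =
    ≤-antisym (minimal (nf w) (≈-sym (≈-nf w))) (subst (∣ w ∣ ≤_) ∣v∣≡n (∣∣-minimal v≈w))

  StartsWith : Letter k → Word k → Set
  StartsWith a w = ∀ c d → Incident (gen a) c d → head (π w c d) ≡ just a

  record FirstOccurrence (a : Letter k) (w : Word k) : Set where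
    field
      prefix suffix : Word k
      split : w ≡ prefix ++ a ∷ suffix
      prefix-commutes : All (Commute a) prefix

    ≈-moved : w ≈ a ∷ prefix ++ suffix
    ≈-moved = subst (_≈ a ∷ prefix ++ suffix) (sym split) (move-∷ {a} prefix suffix prefix-commutes)

    length-split : length w ≡ suc (length (prefix ++ suffix))
    length-split = trans (cong length split) (length-++-sucʳ prefix a suffix)

  firstOccurrence : ∀ {a} w → StartsWith a w → FirstOccurrence a w
  firstOccurrence {a} [] h = contradiction (h _ _ (incident-diag (gen a))) λ ()
  firstOccurrence {a} (b ∷ w) h with linked? (gen a) (gen b)
  ... | yes ab = record
    { prefix = [] ; suffix = w ; prefix-commutes = []
    ; split = cong (_∷ w) (just-injective (trans (sym (cong head (π-∷-yes {b} {w} (right ab)))) (h _ _ (left ab)))) }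
  ... | no ab = record
    { prefix = b ∷ prefix ; suffix = suffix ; split = cong (b ∷_) split ; prefix-commutes = ab ∷ prefix-commutes }
    where
    open FirstOccurrence (firstOccurrence w λ c d i →
      trans (cong head (sym (π-∷-no {b} {w} (incident-commuting {a} {b} ab i)))) (h c d i))

  reduced⇒¬startsWith-inverse : ∀ {a w} → Reduced (a ∷ w) → ¬ StartsWith (invL a) w
  reduced⇒¬startsWith-inverse {a} {w} red h = <-irrefl refl (begin-strict
    L                <⟨ n<1+n L ⟩
    suc L            ≤⟨ n≤1+n (suc L) ⟩
    suc (suc L)      ≡⟨ cong suc length-split ⟨
    length (a ∷ w)   ≡⟨ reduced⇒∣∣≡length red ⟨
    ∣ a ∷ w ∣        ≤⟨ ∣∣-minimal (≈-sym (≈-trans (≈-∷ a ≈-moved) (cancel-∷ a (prefix ++ suffix)))) ⟩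
    L                ∎)
    where
    open FirstOccurrence (firstOccurrence w h)
    open ≤-Reasoning
    L = length (prefix ++ suffix)

  reduced-tail : ∀ {a w} → Reduced (a ∷ w) → Reduced w
  reduced-tail {a} {w} red = ∣∣≡length⇒reduced w (≤-antisym (∣∣≤length w) (s≤s⁻¹ (begin
    length (a ∷ w)      ≡⟨ reduced⇒∣∣≡length red ⟨
    ∣ [ a ] ++ w ∣      ≤⟨ ∣∣-++ [ a ] w ⟩
    ∣ [ a ] ∣ + ∣ w ∣   ≤⟨ +-monoˡ-≤ ∣ w ∣ (∣∣≤length [ a ]) ⟩
    suc ∣ w ∣           ∎)))
    where open ≤-Reasoning

  startsWith-∷ʳ : ∀ {a} w b → StartsWith a w → StartsWith a (w ∷ʳ b)
  startsWith-∷ʳ w b h c d i = trans (cong head (π-++ w [ b ] c d)) (head-++ (π w c d) (h c d i))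

  last-π-∷ : ∀ {a} w {c d} → π w c d ≢ [] → last (π (a ∷ w) c d) ≡ last (π w c d)
  last-π-∷ {a} w {c} {d} π≢[] = case incident? (gen a) c d of λ where
    (no ¬i) → cong last (π-∷-no {a} {w} ¬i)
    (yes i) → trans (cong last (π-∷-yes {a} {w} i)) (last-∷ π≢[])

  π-∷-last : ∀ {a} w {c d y} → π w c d ≡ [] → last (π (a ∷ w) c d) ≡ just y → a ≡ y
  π-∷-last {a} w {c} {d} π≡[] last≡ = case incident? (gen a) c d of λ where
    (yes i) → just-injective (trans (cong last (sym (trans (π-∷-yes {a} {w} i) (cong (a ∷_) π≡[])))) last≡)
    (no ¬i) → case trans (cong last (sym (trans (π-∷-no {a} {w} ¬i) π≡[]))) last≡ of λ ()

  π-diag-nonempty : ∀ w {m c d} → π w m m ≢ [] → Incident m c d → π w c d ≢ []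
  π-diag-nonempty w {m} ne i with π w m m in π-diag
  ... | [] = contradiction refl ne
  ... | x ∷ _ with ∈-π⁻ w (subst (x ∈_) (sym π-diag) (here refl))
  ...   | x∈w , ix with refl ← incident-diag⇒≡ ix = λ π≡[] → case subst (x ∈_) π≡[] (∈-π⁺ x∈w i) of λ ()

  cancels-∷ : ∀ {a b} r → Cancels b (π (a ∷ r)) → ¬ Cancels b (π r) → StartsWith (invL a) (r ∷ʳ b)
  cancels-∷ {a} {b} r h ¬h with π r (gen b) (gen b) in π-diag
  ... | _ ∷ _ = contradiction (λ c d i → trans (sym (last-π-∷ r (π-diag-nonempty r (≡∷⇒≢[] π-diag) i))) (h c d i)) ¬h
  ... | [] with refl ← π-∷-last r π-diag (h _ _ (incident-diag (gen b))) =
    λ c d i → trans (cong head (trans (π-∷ʳ-yes r i) (cong (_∷ʳ b) (empty i)))) (cong just (sym (invL-involutive b)))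
    where
    empty : ∀ {c d} → Incident (gen b) c d → π r c d ≡ []
    empty {c} {d} i with π r c d in π≡
    ... | []    = refl
    ... | _ ∷ _ = case subst (invL b ∈_) π-diag (∈-π⁺ b⁻¹∈r (incident-diag (gen b))) of λ ()
      where
      b⁻¹∈r : invL b ∈ r
      b⁻¹∈r = proj₁ (∈-π⁻ r (last-∈ (π r c d) (trans (sym (last-π-∷ r (≡∷⇒≢[] π≡))) (h c d i))))

  reduced-∷ : ∀ {a w} → Reduced w → ¬ StartsWith (invL a) w → Reduced (a ∷ w)
  reduced-∷ {a} [] _ = snoc a [] λ h → case h _ _ (incident-diag (gen a)) of λ ()
  reduced-∷ {a} (snoc {r} b red ¬cb) ¬sw =
    snoc b (reduced-∷ red (¬sw ∘ startsWith-∷ʳ r b)) (¬sw ∘ λ h → cancels-∷ r h ¬cb)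

  -- Joins of words with comparable stacks

  Compatible : Word k → Word k → Set
  Compatible r s = ∀ c d → Comparable (π r c d) (π s c d)

  infix 4 _≼_
  _≼_ : Word k → Word k → Set
  r ≼ w = Σ (Word k) λ u → w ≈ r ++ u × length w ≡ length r + length u

  ≼-∷ : ∀ a {r w} → r ≼ w → a ∷ r ≼ a ∷ w
  ≼-∷ a (u , w≈ru , len) = u , ≈-∷ a w≈ru , cong suc len

  ≼-respˡ : ∀ {r r′ w} → r ≈ r′ → length r ≡ length r′ → r′ ≼ w → r ≼ w
  ≼-respˡ {r} r≈r′ len≡ (u , w≈r′u , len) =
    u , ≈-trans w≈r′u (≈-++ʳ u (≈-sym r≈r′)) , trans len (cong (_+ length u) (sym len≡))

  ≼-trans : ∀ {r s w} → r ≼ s → s ≼ w → r ≼ w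
  ≼-trans {r} {s} {w} (u , s≈ru , len-s) (v , w≈sv , len-w) =
      u ++ v
    , ≈-trans w≈sv (≈-trans (≈-++ʳ v s≈ru) (≡⇒≈ (++-assoc r u v)))
    , (begin
      length w                       ≡⟨ len-w ⟩
      length s + length v            ≡⟨ cong (_+ length v) len-s ⟩
      length r + length u + length v ≡⟨ +-assoc (length r) _ _ ⟩
      length r + (length u + length v) ≡⟨ cong (length r +_) (length-++ u) ⟨
      length r + length (u ++ v)     ∎)
    where open ≡-Reasoning

  ≼⇒π-prefix : ∀ {r w} → Reduced w → r ≼ w → ∀ c d → Prefix _≡_ (π r c d) (π w c d)
  ≼⇒π-prefix {r} {w} red-w (u , w≈ru , len) c d =
    subst (Prefix _≡_ (π r c d)) (sym (trans (π≐ c d) (π-++ r u c d)))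
          (∣ˡ-as-Prefix record { quotient = π u c d ; equality = refl })
    where
    red-ru : Reduced (r ++ u)
    red-ru = ∣∣≡length⇒reduced (r ++ u) (begin
      ∣ r ++ u ∣            ≡⟨ ∣∣-resp-≈ w≈ru ⟨
      ∣ w ∣                 ≡⟨ reduced⇒∣∣≡length red-w ⟩
      length w              ≡⟨ len ⟩
      length r + length u   ≡⟨ length-++ r ⟨
      length (r ++ u)       ∎)
      where open ≡-Reasoning
    π≐ : π w ≐ π (r ++ u)
    π≐ = ≈⇒π≐ red-w red-ru w≈ru

  record Join (r s : Word k) : Set where
    field
      join : Word k
      reduced : Reduced join
      ≼-left : r ≼ join
      ≼-right : s ≼ join
      π-join : ∀ c d → π join c d ≡ π r c d ⊎ π join c d ≡ π s c d

  startsWith-transfer : ∀ {b x y j} → (∀ c d → π j c d ≡ π x c d ⊎ π j c d ≡ π y c d) → Compatible x y →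
                        π j (gen b) (gen b) ≡ π x (gen b) (gen b) → StartsWith b j → StartsWith b x
  startsWith-transfer {b} {x} {y} {j} π-j compat π-diag h c d i with π-j c d
  ... | inj₁ π≡ = trans (cong head (sym π≡)) (h c d i)
  ... | inj₂ π≡ = comparable-head (compat c d) nonempty (trans (cong head (sym π≡)) (h c d i))
    where
    b∈π-diag : b ∈ π x (gen b) (gen b)
    b∈π-diag = subst (b ∈_) π-diag (head-∈ (π j (gen b) (gen b)) (h _ _ (incident-diag (gen b))))
    nonempty : π x c d ≢ []
    nonempty π≡[] = case subst (b ∈_) π≡[] (∈-π⁺ (proj₁ (∈-π⁻ x b∈π-diag)) i) of λ ()

  ¬startsWith-join : ∀ {b x y} (J : Join x y) → Compatible x y →
                     ¬ StartsWith b x → ¬ StartsWith b y → ¬ StartsWith b (Join.join J)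
  ¬startsWith-join {b} {x} {y} J compat ¬x ¬y h with Join.π-join J (gen b) (gen b)
  ... | inj₁ π≡ = ¬x (startsWith-transfer {b} {x} {y} {Join.join J} (Join.π-join J) compat π≡ h)
  ... | inj₂ π≡ = ¬y (startsWith-transfer {b} {y} {x} {Join.join J} (λ c d → Sum.swap (Join.π-join J c d))
                                          (λ c d → comparable-sym (compat c d)) π≡ h)

  π-∷-cong : ∀ a {u v c d} → π u c d ≡ π v c d → π (a ∷ u) c d ≡ π (a ∷ v) c d
  π-∷-cong a {u} {v} {c} {d} e = case incident? (gen a) c d of λ where
    (yes i) → trans (π-∷-yes {a} {u} i) (trans (cong (a ∷_) e) (sym (π-∷-yes {a} {v} i)))
    (no ¬i) → trans (π-∷-no {a} {u} ¬i) (trans e (sym (π-∷-no {a} {v} ¬i)))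

  compatible-∷ : ∀ a {x y} → Compatible (a ∷ x) (a ∷ y) → Compatible x y
  compatible-∷ a {x} {y} compat c d = case incident? (gen a) c d of λ where
    (yes i) → comparable-tail (subst₂ Comparable (π-∷-yes {a} {x} i) (π-∷-yes {a} {y} i) (compat c d))
    (no ¬i) → subst₂ Comparable (π-∷-no {a} {x} ¬i) (π-∷-no {a} {y} ¬i) (compat c d)

  compatible-startsWith : ∀ {a r s} → Compatible r (a ∷ s) → π r (gen a) (gen a) ≢ [] → StartsWith a r
  compatible-startsWith {a} {r} {s} compat ne c d i =
    comparable-head (compat c d) (π-diag-nonempty r ne i) (cong head (π-∷-yes {a} {s} i))

  module JoinShared {a r s} (red-r : Reduced r) (red-as : Reduced (a ∷ s)) (compat : Compatible r (a ∷ s))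
                    (starts : StartsWith a r) where
    open FirstOccurrence (firstOccurrence r starts)

    rest : Word k
    rest = prefix ++ suffix

    red-a∷rest : Reduced (a ∷ rest)
    red-a∷rest = ∣∣≡length⇒reduced (a ∷ rest)
      (trans (sym (∣∣-resp-≈ ≈-moved)) (trans (reduced⇒∣∣≡length red-r) length-split))

    π-r : π r ≐ π (a ∷ rest)
    π-r = ≈⇒π≐ red-r red-a∷rest ≈-moved

    compatible-rest : Compatible rest s
    compatible-rest = compatible-∷ a λ c d → subst (λ xs → Comparable xs (π (a ∷ s) c d)) (π-r c d) (compat c d)

    extend : Join rest s → Join r (a ∷ s)
    extend J = record
      { join = a ∷ join
      ; reduced = reduced-∷ reduced (¬startsWith-join J compatible-rest
                    (reduced⇒¬startsWith-inverse red-a∷rest) (reduced⇒¬startsWith-inverse red-as))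
      ; ≼-left = ≼-respˡ ≈-moved length-split (≼-∷ a ≼-left)
      ; ≼-right = ≼-∷ a ≼-right
      ; π-join = λ c d → Sum.map (λ e → trans (π-∷-cong a {join} {rest} e) (sym (π-r c d)))
                                 (π-∷-cong a {join} {s}) (π-join c d) }
      where open Join J

  module JoinAbsent {a r s} (red-as : Reduced (a ∷ s)) (compat : Compatible r (a ∷ s))
                    (absent : π r (gen a) (gen a) ≡ []) where

    -- A nonempty stack of r at a pair incident to gen a would begin with a,
    -- and a would then also lie on the empty diagonal stack.
    π-r-empty : ∀ {c d} → Incident (gen a) c d → π r c d ≡ []
    π-r-empty {c} {d} i with π r c d in π≡
    ... | []    = refl
    ... | _ ∷ _ = case subst (a ∈_) absent (∈-π⁺ a∈r (incident-diag (gen a))) of λ ()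
      where
      a∈r : a ∈ r
      a∈r = proj₁ (∈-π⁻ r (head-∈ (π r c d) (comparable-head (compat c d) (≡∷⇒≢[] π≡) (cong head (π-∷-yes {a} {s} i)))))

    r-commutes : All (Commute a) r
    r-commutes = tabulate λ {b} b∈r ab → case subst (b ∈_) (π-r-empty (left ab)) (∈-π⁺ b∈r (right ab)) of λ ()

    compatible-s : Compatible r s
    compatible-s c d = case incident? (gen a) c d of λ where
      (yes i) → inj₁ (subst (λ xs → Prefix _≡_ xs (π s c d)) (sym (π-r-empty i)) [])
      (no ¬i) → subst (Comparable (π r c d)) (π-∷-no {a} {s} ¬i) (compat c d)

    extend : Join r s → Join r (a ∷ s)
    extend J = record
      { join = a ∷ join
      ; reduced = reduced-∷ reduced (¬startsWith-join J compatible-s ¬starts-r (reduced⇒¬startsWith-inverse red-as))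
      ; ≼-left = ≼-left′
      ; ≼-right = ≼-∷ a ≼-right
      ; π-join = π-join′ }
      where
      open Join J
      ¬starts-r : ¬ StartsWith (invL a) r
      ¬starts-r h = case trans (sym (cong head absent)) (h _ _ (incident-diag (gen a))) of λ ()
      ≼-left′ : r ≼ a ∷ join
      ≼-left′ with u , j≈ru , len ← ≼-left =
          a ∷ u
        , ≈-trans (≈-∷ a j≈ru) (≈-sym (move-∷ {a} r u r-commutes))
        , trans (cong suc len) (sym (+-suc (length r) (length u)))
      π-join≡π-s : ∀ {c d} → Incident (gen a) c d → π join c d ≡ π s c d
      π-join≡π-s {c} {d} i with π-join c d
      ... | inj₂ e = e
      ... | inj₁ e =
        trans π-join≡[] (sym (prefix-[] (subst (Prefix _≡_ (π s c d)) π-join≡[] (≼⇒π-prefix reduced ≼-right c d))))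
        where
        π-join≡[] : π join c d ≡ []
        π-join≡[] = trans e (π-r-empty i)
      π-join′ : ∀ c d → π (a ∷ join) c d ≡ π r c d ⊎ π (a ∷ join) c d ≡ π (a ∷ s) c d
      π-join′ c d = case incident? (gen a) c d of λ where
        (yes i) → inj₂ (π-∷-cong a {join} {s} (π-join≡π-s i))
        (no ¬i) → Sum.map (trans (π-∷-no {a} {join} ¬i)) (π-∷-cong a {join} {s}) (π-join c d)

  compatible⇒join : ∀ {r} s → Reduced r → Reduced s → Compatible r s → Join r s
  compatible⇒join {r} [] red-r _ _ = record
    { join = r ; reduced = red-r
    ; ≼-left = [] , ≡⇒≈ (sym (++-identityʳ r)) , sym (+-identityʳ _)
    ; ≼-right = r , ≈-refl , refl
    ; π-join = λ _ _ → inj₁ refl }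
  compatible⇒join {r} (a ∷ s) red-r red-as compat with π r (gen a) (gen a) in π-diag
  ... | [] = JoinAbsent.extend red-as compat π-diag
               (compatible⇒join s red-r (reduced-tail red-as) (JoinAbsent.compatible-s {a} {r} {s} red-as compat π-diag))
  ... | _ ∷ _ = JoinShared.extend red-r red-as compat starts
                  (compatible⇒join s (reduced-tail (JoinShared.red-a∷rest red-r red-as compat starts)) (reduced-tail red-as)
                        (JoinShared.compatible-rest red-r red-as compat starts))
    where
    starts : StartsWith a r
    starts = compatible-startsWith {a} {r} {s} compat (≡∷⇒≢[] π-diag)

  record UpperBound {t} (rs : Fin t → Word k) : Set where
    field
      bound : Word k
      reduced : Reduced bound
      above : ∀ i → rs i ≼ bound
      π-bound : ∀ c d → π bound c d ≡ [] ⊎ Σ (Fin t) λ i → π bound c d ≡ π (rs i) c d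

  compatible⇒upperBound : ∀ {t} (rs : Fin t → Word k) → (∀ i → Reduced (rs i)) →
                          (∀ i j → Compatible (rs i) (rs j)) → UpperBound rs
  compatible⇒upperBound {zero} rs _ _ = record
    { bound = [] ; reduced = [] ; above = λ () ; π-bound = λ _ _ → inj₁ refl }
  compatible⇒upperBound {suc t} rs red compat = record
    { bound = join
    ; reduced = reduced
    ; above = λ where
        zero    → ≼-right
        (suc i) → ≼-trans (U.above i) ≼-left
    ; π-bound = λ c d → case π-join c d of λ where
        (inj₂ e) → inj₂ (zero , e)
        (inj₁ e) → Sum.map (trans e) (λ (i , e′) → suc i , trans e e′) (U.π-bound c d) }
    where
    module U = UpperBound (compatible⇒upperBound (rs ∘ suc) (red ∘ suc) (λ i j → compat (suc i) (suc j)))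
    compatible-bound : Compatible U.bound (rs zero)
    compatible-bound c d with U.π-bound c d
    ... | inj₁ e       = inj₁ (subst (λ xs → Prefix _≡_ xs (π (rs zero) c d)) (sym e) [])
    ... | inj₂ (i , e) = subst (λ xs → Comparable xs (π (rs zero) c d)) (sym e) (compat (suc i) zero c d)
    open Join (compatible⇒join (rs zero) U.reduced (red zero) compatible-bound)

  below⇒≼ : ∀ {x z} → Below F x z → nf x ≼ nf z
  below⇒≼ {x} {z} (_ , _ , _ , hx , hz , hy , b≡a+c) =
      nf y
    , ≈-trans (≈-sym (≈-nf z)) (≈-trans (≈-sym (++-inv-cancel x z)) (≈-trans (≈-++ʳ y (≈-nf x)) (≈-++ˡ (nf x) (≈-nf y))))
    , trans (sym (HasLength⇒≡∣∣ hz)) (trans b≡a+c (cong₂ _+_ (HasLength⇒≡∣∣ hx) (HasLength⇒≡∣∣ hy)))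
    where
    y = inv x ++ z

  ≼⇒below : ∀ {x m} → Reduced m → nf x ≼ m → Below F x m
  ≼⇒below {x} {m} red-m (u , m≈xu , len) =
      ∣ x ∣ , ∣ m ∣ , ∣ y ∣ , hasLength x , hasLength m , hasLength y
    , trans (reduced⇒∣∣≡length red-m) (trans len (cong (∣ x ∣ +_) (sym ∣y∣≡∣u∣)))
    where
    y = inv x ++ m
    y≈u : y ≈ u
    y≈u = ≈-trans (≈-++ˡ (inv x) (≈-trans m≈xu (≈-++ʳ u (≈-sym (≈-nf x))))) (inv-++-cancel x u)
    ∣y∣≡∣u∣ : ∣ y ∣ ≡ length u
    ∣y∣≡∣u∣ = ≤-antisym (∣∣-minimal (≈-sym y≈u)) (+-cancelˡ-≤ ∣ x ∣ _ _ (begin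
      ∣ x ∣ + length u   ≡⟨ len ⟨
      length m           ≡⟨ reduced⇒∣∣≡length red-m ⟨
      ∣ m ∣              ≡⟨ ∣∣-resp-≈ (++-inv-cancel x m) ⟨
      ∣ x ++ y ∣         ≤⟨ ∣∣-++ x y ⟩
      ∣ x ∣ + ∣ y ∣      ∎))
      where open ≤-Reasoning

proposition1 : (k : ℕ) (F : Pairs k) (t : ℕ) (x : Fin t → Word k) →
    (∀ (i j : Fin t) → JoinFinite F (pair (x i) (x j))) →
    JoinFinite F x
proposition1 k F t x pairwise = bound , λ i → ≼⇒below reduced (above i)
  where
  open Projections F
  compatible : ∀ i j → Compatible (nf (x i)) (nf (x j))
  compatible i j c d with pairwise i j
  ... | z , below = prefixes-comparable (π-prefix (below zero)) (π-prefix (below (suc zero)))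
    where
    π-prefix : ∀ {y} → Below F y z → Prefix _≡_ (π (nf y) c d) (π (nf z) c d)
    π-prefix b = ≼⇒π-prefix (nf-reduced z) (below⇒≼ b) c d
  open UpperBound (compatible⇒upperBound (nf ∘ x) (nf-reduced ∘ x) compatible)
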